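{- Let $w_1=\langle A_1,D_1,n_1\rangle$ and $w_2=\langle A_2,D_2,n_2\rangle$ be indexed containers over $I_1$ and $I_2$, and let $i_1:I_1$, $i_2:I_2$. Let $(R,\rho):\mathcal L(w_1^\bot,i_1)^{\bot\ast}\multimap\mathcal L(w_2^\bot,i_2)^\bot$ be a general layered simulation. Then the type $$R(\mathtt{Leaf},\mathtt{Leaf})\to(i_1\in\nu_{w_1^\bot})\to(i_2\in\nu_{w_2^\bot})$$ is inhabited.
   Context: Martin-Löf type theory with universe $\mathsf{Set}$, identity type $\equiv$, inductive-recursive definitions and coinductive types. A predicate on $I$ is $X:I\to\mathsf{Set}$; $i\in X$ means $X(i)$; $X\subseteq Y$ means $\prod_i X(i)\to Y(i)$. $\mathbf 1$ is the unit type with element $\star$. Indexed container over $I$: $w=\langle A,D,n\rangle$ with $A(i):\mathsf{Set}$, $D(i,a):\mathsf{Set}$, $n(i,a,d):I$ (written $i[a/d]$). Extension $i\in[\![w]\!](X)=\sum_{a:A(i)}\prod_{d:D(i,a)}i[a/d]\in X$. Dual $w^\bot$: $A^\bot(i)=\prod_{a:A(i)}D(i,a)$, $D^\bot(i,f)=A(i)$, $n^\bot(i,f,a)=i[a/f\,a]$. $\nu_w$ is the coinductive predicate with $\nu\mathrm{elim}:\nu_w\subseteq[\![w]\!](\nu_w)$ and, for each $c:X\subseteq[\![w]\!](X)$, $\nu\mathrm{intro}\,c:X\subseteq\nu_w$ (with the usual computation rule). Free container $w^\ast$: $A^\ast(i)$ is generated by $\mathtt{Leaf}$ and $\mathtt{Node}(a,k)$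 with $a:A(i)$, $k:\prod_{d:D(i,a)}A^\ast(i[a/d])$; $D^\ast(i,\mathtt{Leaf})=\mathbf 1$, $n^\ast(i,\mathtt{Leaf},\star)=i$, $D^\ast(i,\mathtt{Node}(a,k))=\sum_{d}D^\ast(i[a/d],k\,d)$, $n^\ast(i,\mathtt{Node}(a,k),\langle d,d'\rangle)=n^\ast(i[a/d],k\,d,d')$. Layering: for $w=\langle A,D,n\rangle$ over $I$, define by induction-recursion $A^\sharp(i):\mathsf{Set}$, $D^\sharp(i,\alpha):\mathsf{Set}$, $n^\sharp\,i\,\alpha:D^\sharp(i,\alpha)\to I$. The constructors are $\mathtt{Leaf}:A^\sharp(i)$ and $\alpha\triangleleft l:A^\sharp(i)$ for $\alpha:A^\sharp(i)$, $l:\prod_{\beta:D^\sharp(i,\alpha)}A(n^\sharp\,i\,\alpha\,\beta)$. The recursive parts are $D^\sharp(i,\mathtt{Leaf})=\mathbf 1$, $n^\sharp\,i\,\mathtt{Leaf}\,\star=i$, $D^\sharp(i,\alpha\triangleleft l)=\sum_{\beta:D^\sharp(i,\alpha)}D(n^\sharp\,i\,\alpha\,\beta,\,l\,\beta)$, and $n^\sharp\,i\,(\alpha\triangleleft l)\,\langle\beta,d\rangle=n(n^\sharp\,i\,\alpha\,\beta,\ l\,\beta,\ d)$. For fixed $i:I$ the indexed container $\mathcal L(w,i)$ has index set $A^\sharp(i)$, actions at $\alpha$ the layers $l:\prod_{\beta:D^\sharp(i,\alpha)}A(n^\sharp\,i\,\alpha\,\beta)$, a single response $\star$, and next state $\alpha\triangleleft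 l$. Linear simulation $(R,\rho):v_1\multimap v_2$ between $v_k=\langle A_k,D_k,n_k\rangle$ over $J_k$: $R:J_1\times J_2\to\mathsf{Set}$ with $\rho:\prod_{j_1,j_2}R(j_1,j_2)\to\prod_{a_2}\sum_{a_1}\prod_{d_1}\sum_{d_2}R(j_1[a_1/d_1],j_2[a_2/d_2])$. A general layered simulation from $w_1$ to $w_2$ at $i_1,i_2$ is a linear simulation from $(\mathcal L(w_1^\bot,i_1)^\bot)^\ast$ to $\mathcal L(w_2^\bot,i_2)^\bot$; its relation is on $A_1^{\bot\sharp}(i_1)\times A_2^{\bot\sharp}(i_2)$, where $A_k^{\bot\sharp}$ is the layering index set of $w_k^\bot$. -}

module Defs where

open import Level using (Level)
open import Data.Unit using (⊤; tt)
open import Data.Product using (Σ; _,_; proj₁; proj₂)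

record IC (I : Set) : Set₁ where
  constructor ⟨_,_,_⟩
  field
    A : I → Set
    D : (i : I) → A i → Set
    n : (i : I) (a : A i) → D i a → I
open IC public

Pred : Set → Set₁
Pred I = I → Set

_⊆_ : {I : Set} → Pred I → Pred I → Set
X ⊆ Y = ∀ i → X i → Y i

⟦_⟧ : {ℓ : Level} {I : Set} → IC I → (I → Set ℓ) → (I → Set ℓ)
⟦ w ⟧ X i = Σ (A w i) λ a → (d : D w i a) → X (n w i a d)

_⊥ : {I : Set} → IC I → IC I
A (w ⊥) i = (a : A w i) → D w i a
D (w ⊥) i f = A w i
n (w ⊥) i f a = n w i a (f a)

record ν {I : Set} (w : IC I) (i : I) : Set₁ where
  constructor νmk
  field
    Carrier : Pred I
    coalg   : Carrier ⊆ ⟦ w ⟧ Carrier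
    seed    : Carrier i
open ν public

νintro : {I : Set} {w : IC I} {X : Pred I} → X ⊆ ⟦ w ⟧ X → ∀ i → X i → ν w i
νintro {X = X} c i x = νmk X c x

νelim : {I : Set} {w : IC I} → ∀ i → ν w i → ⟦ w ⟧ (ν w) i
νelim i (νmk X c x) = proj₁ (c i x) , λ d → νmk X c (proj₂ (c i x) d)

data A* {I : Set} (w : IC I) (i : I) : Set where
  Leaf : A* w i
  Node : (a : A w i) → ((d : D w i a) → A* w (n w i a d)) → A* w i

D* : {I : Set} (w : IC I) (i : I) → A* w i → Set
D* w i Leaf = ⊤
D* w i (Node a k) = Σ (D w i a) λ d → D* w (n w i a d) (k d)

n* : {I : Set} (w : IC I) (i : I) (t : A* w i) → D* w i t → I
n* w i Leaf tt = i
n* w i (Node a k) (d , d′) = n* w (n w i a d) (k d) d′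

_* : {I : Set} → IC I → IC I
w * = ⟨ A* w , D* w , n* w ⟩

mutual
  data A♯ {I : Set} (w : IC I) (i : I) : Set where
    Leaf : A♯ w i
    _◁_ : (α : A♯ w i) → ((β : D♯ w i α) → A w (n♯ w i α β)) → A♯ w i

  D♯ : {I : Set} (w : IC I) (i : I) → A♯ w i → Set
  D♯ w i Leaf = ⊤
  D♯ w i (α ◁ l) = Σ (D♯ w i α) λ β → D w (n♯ w i α β) (l β)

  n♯ : {I : Set} (w : IC I) (i : I) (α : A♯ w i) → D♯ w i α → I
  n♯ w i Leaf tt = i
  n♯ w i (α ◁ l) (β , d) = n w (n♯ w i α β) (l β) d

L : {I : Set} (w : IC I) (i : I) → IC (A♯ w i)
A (L w i) α = (β : D♯ w i α) → A w (n♯ w i α β)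
D (L w i) α l = ⊤
n (L w i) α l tt = α ◁ l

LinSimStep : {J₁ J₂ : Set} (v₁ : IC J₁) (v₂ : IC J₂) → (J₁ → J₂ → Set) → Set
LinSimStep v₁ v₂ R =
  ∀ j₁ j₂ → R j₁ j₂ →
    (a₂ : A v₂ j₂) → Σ (A v₁ j₁) λ a₁ → (d₁ : D v₁ j₁ a₁) →
      Σ (D v₂ j₂ a₂) λ d₂ → R (n v₁ j₁ a₁ d₁) (n v₂ j₂ a₂ d₂)

record _⊸_ {J₁ J₂ : Set} (v₁ : IC J₁) (v₂ : IC J₂) : Set₁ where
  field
    R : J₁ → J₂ → Set
    ρ : LinSimStep v₁ v₂ R
open _⊸_ public

GenLayeredSim : {I₁ I₂ : Set} (w₁ : IC I₁) (w₂ : IC I₂) (i₁ : I₁) (i₂ : I₂) → Set₁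
GenLayeredSim w₁ w₂ i₁ i₂ = ((L (w₁ ⊥) i₁ ⊥) *) ⊸ (L (w₂ ⊥) i₂ ⊥)

{-# OPTIONS --safe #-}
module Submission where

open import Defs
open import Data.Unit using (tt)
open import Data.Product using (Σ; _×_; _,_; proj₁; proj₂)
open import Relation.Binary.PropositionalEquality using (_≡_; refl)

-- The witnesses in ν (w₁ ⊥) i₁ are layerings of w₁ ⊥ whose leaves all lie in
-- a coalgebra Y.  Against any tree of challenges the simulation poses, such a
-- layering can be grown layer by layer using Y, so every layering of w₂ ⊥ the
-- simulation relates to it can be grown by one more layer.  The leaves of all
-- layerings of w₂ ⊥ obtained this way form a w₂ ⊥ -coalgebra containing i₂.

module _ {I : Set} (v : IC I) (i : I) where

  AllLeaves : Pred I → A♯ v i → Set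
  AllLeaves Y α = (β : D♯ v i α) → Y (n♯ v i α β)

  LeafOf : (A♯ v i → Set) → Pred I
  LeafOf P j = Σ (A♯ v i) λ α → P α × Σ (D♯ v i α) λ β → n♯ v i α β ≡ j

  Extendable : (A♯ v i → Set) → Set
  Extendable P = ∀ α → P α → Σ (A (L v i) α) λ l → P (α ◁ l)

  LeafOf-coalg : {P : A♯ v i → Set} → Extendable P → LeafOf P ⊆ ⟦ v ⟧ (LeafOf P)
  LeafOf-coalg extend _ (α , p , β , refl) =
    let (l , p′) = extend α p
    in l β , λ d → α ◁ l , p′ , (β , d) , refl

  Extendable⇒ν : {P : A♯ v i → Set} → Extendable P → P Leaf → ν v i
  Extendable⇒ν extend p = νintro (LeafOf-coalg extend) i (Leaf , p , tt , refl)

  module _ {Y : Pred I} (cy : Y ⊆ ⟦ v ⟧ Y) where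

    AllLeaves-extendable : Extendable (AllLeaves Y)
    AllLeaves-extendable α p = (λ β → proj₁ (cy _ (p β))) , λ (β , d) → proj₂ (cy _ (p β)) d

    AllLeaves-path : ∀ α → AllLeaves Y α → (t : A* (L v i ⊥) α) →
      Σ (D* (L v i ⊥) α t) λ d → AllLeaves Y (n* (L v i ⊥) α t d)
    AllLeaves-path α p Leaf = tt , p
    AllLeaves-path α p (Node _ k) =
      let (l , p′) = AllLeaves-extendable α p
          (d , q) = AllLeaves-path (α ◁ l) p′ (k l)
      in (l , d) , q

module _ {I₁ I₂ : Set} (w₁ : IC I₁) (w₂ : IC I₂) {i₁ : I₁} {i₂ : I₂}
         (S : GenLayeredSim w₁ w₂ i₁ i₂) {Y : Pred I₁} (cy : Y ⊆ ⟦ w₁ ⊥ ⟧ Y) where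

  SimulatedBy : A♯ (w₂ ⊥) i₂ → Set
  SimulatedBy α₂ = Σ (A♯ (w₁ ⊥) i₁) λ α₁ → R S α₁ α₂ × AllLeaves (w₁ ⊥) i₁ Y α₁

  SimulatedBy-extendable : Extendable (w₂ ⊥) i₂ SimulatedBy
  SimulatedBy-extendable α₂ (α₁ , r , p) =
    let (t , answer) = ρ S α₁ α₂ r (λ _ → tt)
        (d₁ , p′) = AllLeaves-path (w₁ ⊥) i₁ cy α₁ p t
        (l₂ , r′) = answer d₁
    in l₂ , _ , r′ , p′

lemma5p8 : {I₁ I₂ : Set} (w₁ : IC I₁) (w₂ : IC I₂) (i₁ : I₁) (i₂ : I₂)
    (S : GenLayeredSim w₁ w₂ i₁ i₂) →
    R S Leaf Leaf → ν (w₁ ⊥) i₁ → ν (w₂ ⊥) i₂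
lemma5p8 w₁ w₂ i₁ i₂ S r (νmk Y cy y) =
  Extendable⇒ν (w₂ ⊥) i₂ (SimulatedBy-extendable w₁ w₂ S cy) (Leaf , r , λ _ → y)
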